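{- Let $m$ be a positive integer and $\lambda$ a nonzero real number. For every $n\ge0$, $$D_{m,\lambda}(n+1)=\sum_{l=0}^{n}\sum_{i=0}^{l}\binom{l}{i}\binom{n}{l}(n-l)!\,(-\lambda)^{n-l}(m)_{i,\lambda}\,D_{m,\lambda}(l-i)\,(1+\delta_{0,i}),$$ where $\delta$ is the Kronecker delta.
   Context: For a nonzero real $\lambda$: $(x)_{0,\lambda}=1$, $(x)_{n,\lambda}=x(x-\lambda)\cdots(x-(n-1)\lambda)$; $(x)_n=(x)_{n,1}$. Degenerate Whitney numbers of the second kind $W_{m,\lambda}(n,k)$: $(mx+1)_{n,\lambda}=\sum_{k=0}^{n}W_{m,\lambda}(n,k)m^{k}(x)_{k}$. Degenerate Dowling numbers: $D_{m,\lambda}(n)=\sum_{k=0}^{n}W_{m,\lambda}(n,k)$. -}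

module Defs where

open import Level using (_⊔_)
open import Data.Nat using (ℕ; zero; suc; _∸_)
open import Data.Nat.Combinatorics using (_C_)
open import Data.Nat.Base using (_!)
open import Data.Sum using (_⊎_)
open import Relation.Binary.PropositionalEquality using (_≡_)
open import Algebra.Bundles using (CommutativeRing)
import Algebra.Bundles
import Algebra.Definitions.RawSemiring as RS

-- All notions are defined over an arbitrary commutative ring R
-- (intended instance: the real numbers).
module _ {c ℓ} (R : CommutativeRing c ℓ) where
  open CommutativeRing R
  open RS (Algebra.Bundles.Semiring.rawSemiring semiring) using (_×_; _^_)

  -- R has characteristic zero and no additive torsion
  -- (true for ℝ, and for any field of characteristic 0).
  TorsionFree : Set (c ⊔ ℓ)
  TorsionFree = ∀ (k : ℕ) (a : Carrier) → (k × a) ≈ 0# → k ≡ 0 ⊎ a ≈ 0#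

  sumTo : (ℕ → Carrier) → ℕ → Carrier
  sumTo f zero    = f 0
  sumTo f (suc n) = sumTo f n + f (suc n)

  prodBelow : (ℕ → Carrier) → ℕ → Carrier
  prodBelow f zero    = 1#
  prodBelow f (suc n) = prodBelow f n * f n

  fallλ : Carrier → ℕ → Carrier → Carrier
  fallλ x n lam = prodBelow (λ j → x - (j × lam)) n

  fall : Carrier → ℕ → Carrier
  fall x n = fallλ x n 1#

  ⟦_⟧ : ℕ → Carrier
  ⟦ k ⟧ = k × 1#

  IsDegWhitney2 : ℕ → Carrier → (ℕ → ℕ → Carrier) → Set (c ⊔ ℓ)
  IsDegWhitney2 m lam W = ∀ (n : ℕ) (x : Carrier) →
    fallλ (⟦ m ⟧ * x + 1#) n lam ≈ sumTo (λ k → W n k * (⟦ m ⟧ ^ k) * fall x k) n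

  Dowling : (ℕ → ℕ → Carrier) → ℕ → Carrier
  Dowling W n = sumTo (λ k → W n k) n

  onePlusδ : ℕ → Carrier
  onePlusδ zero    = 1# + 1#
  onePlusδ (suc _) = 1#

  theorem17-rhs : ℕ → Carrier → (ℕ → ℕ → Carrier) → ℕ → Carrier
  theorem17-rhs m lam W n =
    sumTo (λ l → sumTo (λ i →
        ⟦ l C i ⟧ * ⟦ n C l ⟧ * ⟦ (n ∸ l) ! ⟧ * ((- lam) ^ (n ∸ l))
        * fallλ ⟦ m ⟧ i lam * Dowling W (l ∸ i) * onePlusδ i) l) n

-- Over a torsion-free ring the coefficients of a polynomial in the basis (x)_k can be read off
-- from its values at x = 0, 1, …, n, so W coincides with the sequence `whitney` obtained from
-- (mx+1)_{n+1,λ} = (mx+1)_{n,λ} (mx + 1 - nλ), and D(n) is the sum of the coefficients of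
-- (mx+1)_{n,λ} in the basis m^k (x)_k. Summing coefficients turns multiplication by mx into the
-- shift x ↦ x + 1, and the degenerate Vandermonde identity
-- (m(x+1)+1)_{n,λ} = Σ_i C(n,i) (m)_{i,λ} (mx+1)_{n-i,λ} then yields the recurrence
-- D(n+1) = Σ_i C(n,i) (m)_{i,λ} D(n-i) + (1 - nλ) D(n). Thus the inner sum of the theorem is
-- D(l+1) + lλ D(l), and the weights C(n,l) (n-l)! (-λ)^{n-l} telescope these to D(n+1).

module Submission where

open import Algebra.Bundles using (CommutativeRing; Semiring)
import Algebra.Definitions.RawSemiring as RawSemiringDefs
import Algebra.Properties.AbelianGroup as AbelianGroupProperties
import Algebra.Properties.Group as GroupProperties
import Algebra.Properties.Monoid.Mult as MonoidMultiplication
import Algebra.Properties.Ring as RingProperties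
import Algebra.Properties.Semiring.Mult as SemiringMultiplication
import Algebra.Solver.Ring.NaturalCoefficients.Default as SemiringSolver
open import Data.Nat as ℕ using (ℕ; zero; suc; _∸_; _≤_; _<_; _≥_; z≤n; s≤s; _!; NonZero)
open import Data.Nat.DivMod using (m/n*n≡m)
open import Data.Nat.Tactic.RingSolver using (solve-∀)
open import Data.Nat.Combinatorics
  using (_C_; nCn≡1; k>n⇒nCk≡0; nCk+nC[k+1]≡[n+1]C[k+1]; [n-k]*[n-k-1]!≡[n-k]!; nCk≡n!/k![n-k]!; k![n∸k]!∣n!)
import Data.Nat.Properties as ℕ
open import Data.Nat.Induction using (<-rec)
open import Data.Sum using (inj₁; inj₂)
open import Relation.Binary.PropositionalEquality as ≡ using (_≡_)
open import Relation.Nullary using (¬_; contradiction)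
open import Defs using (TorsionFree; IsDegWhitney2; Dowling; theorem17-rhs)
import Defs

module _ where
  open import Data.Nat using (_*_)

  nCk*[k!*[n∸k]!]≡n! : ∀ {n k} → k ≤ n → (n C k) * (k ! * (n ∸ k) !) ≡ n !
  nCk*[k!*[n∸k]!]≡n! {n} {k} k≤n =
    ≡.trans (≡.cong (_* (k ! * (n ∸ k) !)) (nCk≡n!/k![n-k]! k≤n)) (m/n*n≡m {{k ℕ.!* (n ∸ k) !≢0}} (k![n∸k]!∣n! k≤n))

  [1+n]Cl*[1+n∸l]!≡[1+n]*nCl*[n∸l]! : ∀ {n l} → l ≤ n →
    (suc n C l) * (suc n ∸ l) ! ≡ suc n * ((n C l) * (n ∸ l) !)
  [1+n]Cl*[1+n∸l]!≡[1+n]*nCl*[n∸l]! {n} {l} l≤n = ℕ.*-cancelʳ-≡ _ _ (l !) {{l ℕ.!≢0}} (begin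
    (suc n C l) * (suc n ∸ l) ! * l !      ≡⟨ swap₂₃ (suc n C l) _ _ ⟩
    (suc n C l) * (l ! * (suc n ∸ l) !)    ≡⟨ nCk*[k!*[n∸k]!]≡n! (ℕ.m≤n⇒m≤1+n l≤n) ⟩
    suc n * n !                            ≡⟨ ≡.cong (suc n *_) (nCk*[k!*[n∸k]!]≡n! l≤n) ⟨
    suc n * ((n C l) * (l ! * (n ∸ l) !))  ≡⟨ pull-out (suc n) (n C l) _ _ ⟩
    suc n * ((n C l) * (n ∸ l) !) * l !    ∎)
    where
    open ≡.≡-Reasoning
    swap₂₃ : ∀ a b c → a * b * c ≡ a * (c * b)
    swap₂₃ = solve-∀

    pull-out : ∀ a b c d → a * (b * (c * d)) ≡ a * (b * d) * c
    pull-out = solve-∀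

module DegenerateDowling {c ℓ} (R : CommutativeRing c ℓ) where
  open CommutativeRing R
  open RawSemiringDefs (Semiring.rawSemiring semiring) using (_×_; _^_)
  open MonoidMultiplication +-monoid using (×-homo-+; ×-congʳ)
  open SemiringMultiplication semiring using (×1-homo-*; ×-assoc-*)
  open RingProperties ring using (-‿distribˡ-*; [y-z]x≈yx-zx)
  open AbelianGroupProperties +-abelianGroup using (⁻¹-∙-comm)
  open GroupProperties +-group using (x∙y⁻¹≈ε⇒x≈y; ∙-cancelˡ; //-rightDividesˡ; //-rightDividesʳ)
  -- The solver has ℕ coefficients and no negation: negated terms are handed to it as atoms.
  open SemiringSolver commutativeSemiring using (solve; _:=_; _:+_; _:*_; con)
  open import Relation.Binary.Reasoning.Setoid setoid

  sumTo : (ℕ → Carrier) → ℕ → Carrier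
  sumTo = Defs.sumTo R

  ⟦_⟧ : ℕ → Carrier
  ⟦_⟧ = Defs.⟦_⟧ R

  fall : Carrier → ℕ → Carrier
  fall = Defs.fall R

  fallλ : Carrier → ℕ → Carrier → Carrier
  fallλ = Defs.fallλ R

  onePlusδ : ℕ → Carrier
  onePlusδ = Defs.onePlusδ R

  sumTo-cong : ∀ {f g} n → (∀ k → k ≤ n → f k ≈ g k) → sumTo f n ≈ sumTo g n
  sumTo-cong zero    f≈g = f≈g 0 z≤n
  sumTo-cong (suc n) f≈g = +-cong (sumTo-cong n λ k k≤n → f≈g k (ℕ.m≤n⇒m≤1+n k≤n)) (f≈g (suc n) ℕ.≤-refl)

  sumTo-+ : ∀ f g n → sumTo (λ k → f k + g k) n ≈ sumTo f n + sumTo g n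
  sumTo-+ f g zero    = refl
  sumTo-+ f g (suc n) = begin
    sumTo (λ k → f k + g k) n + (f (suc n) + g (suc n))  ≈⟨ +-congʳ (sumTo-+ f g n) ⟩
    (sumTo f n + sumTo g n) + (f (suc n) + g (suc n))    ≈⟨ +-assoc-swap _ _ _ _ ⟩
    sumTo f (suc n) + sumTo g (suc n)                     ∎
    where
    +-assoc-swap : ∀ a b c d → (a + b) + (c + d) ≈ (a + c) + (b + d)
    +-assoc-swap = solve 4 (λ a b c d → (a :+ b) :+ (c :+ d) := (a :+ c) :+ (b :+ d)) refl

  sumTo-*ˡ : ∀ a f n → sumTo (λ k → a * f k) n ≈ a * sumTo f n
  sumTo-*ˡ a f zero    = refl
  sumTo-*ˡ a f (suc n) = trans (+-congʳ (sumTo-*ˡ a f n)) (sym (distribˡ a _ _))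

  sumTo-zero : ∀ f n → (∀ k → k ≤ n → f k ≈ 0#) → sumTo f n ≈ 0#
  sumTo-zero f zero    f≈0 = f≈0 0 z≤n
  sumTo-zero f (suc n) f≈0 =
    trans (+-cong (sumTo-zero f n λ k k≤n → f≈0 k (ℕ.m≤n⇒m≤1+n k≤n)) (f≈0 (suc n) ℕ.≤-refl)) (+-identityˡ 0#)

  sumTo-comm : ∀ (f : ℕ → ℕ → Carrier) m n →
    sumTo (λ i → sumTo (f i) n) m ≈ sumTo (λ k → sumTo (λ i → f i k) m) n
  sumTo-comm f zero    n = refl
  sumTo-comm f (suc m) n =
    trans (+-congʳ (sumTo-comm f m n)) (sym (sumTo-+ (λ k → sumTo (λ i → f i k) m) (f (suc m)) n))

  sumTo-truncate : ∀ f {j} n → j ≤ n → (∀ k → j < k → k ≤ n → f k ≈ 0#) → sumTo f n ≈ sumTo f j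
  sumTo-truncate f zero    z≤n   _   = refl
  sumTo-truncate f (suc n) j≤1+n f≈0 with ℕ.m≤n⇒m<n∨m≡n j≤1+n
  ... | inj₂ ≡.refl = refl
  ... | inj₁ j<1+n  = trans (+-cong (sumTo-truncate f n (ℕ.≤-pred j<1+n) λ k j<k k≤n → f≈0 k j<k (ℕ.m≤n⇒m≤1+n k≤n))
                                    (f≈0 (suc n) j<1+n ℕ.≤-refl))
                            (+-identityʳ _)

  sumTo-head : ∀ f n → sumTo f (suc n) ≈ f 0 + sumTo (λ k → f (suc k)) n
  sumTo-head f zero    = refl
  sumTo-head f (suc n) = trans (+-congʳ (sumTo-head f n)) (+-assoc _ _ _)

  sumTo-≈⇒last-≈ : ∀ {f g} n → (∀ {k} → k < n → f k ≈ g k) → sumTo f n ≈ sumTo g n → f n ≈ g n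
  sumTo-≈⇒last-≈ zero    _   eq = eq
  sumTo-≈⇒last-≈ (suc n) f≈g eq =
    ∙-cancelˡ (sumTo _ n) _ _ (trans (+-congʳ (sym (sumTo-cong n λ _ k≤n → f≈g (s≤s k≤n)))) eq)

  ⟦1⟧≈1 : ⟦ 1 ⟧ ≈ 1#
  ⟦1⟧≈1 = +-identityʳ 1#

  ⟦⟧-homo-+ : ∀ a b → ⟦ a ℕ.+ b ⟧ ≈ ⟦ a ⟧ + ⟦ b ⟧
  ⟦⟧-homo-+ = ×-homo-+ 1#

  ⟦⟧-homo-* : ∀ a b → ⟦ a ℕ.* b ⟧ ≈ ⟦ a ⟧ * ⟦ b ⟧
  ⟦⟧-homo-* = ×1-homo-*

  ⟦⟧-homo-∸ : ∀ {j k} → k ≤ j → ⟦ j ∸ k ⟧ ≈ ⟦ j ⟧ - ⟦ k ⟧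
  ⟦⟧-homo-∸ {j} {k} k≤j = begin
    ⟦ j ∸ k ⟧                  ≈⟨ //-rightDividesʳ ⟦ k ⟧ ⟦ j ∸ k ⟧ ⟨
    ⟦ j ∸ k ⟧ + ⟦ k ⟧ - ⟦ k ⟧  ≈⟨ +-congʳ (⟦⟧-homo-+ (j ∸ k) k) ⟨
    ⟦ j ∸ k ℕ.+ k ⟧ - ⟦ k ⟧    ≡⟨ ≡.cong (λ i → ⟦ i ⟧ - ⟦ k ⟧) (ℕ.m∸n+n≡m k≤j) ⟩
    ⟦ j ⟧ - ⟦ k ⟧              ∎

  ×≈⟦⟧* : ∀ n x → n × x ≈ ⟦ n ⟧ * x
  ×≈⟦⟧* n x = sym (trans (×-assoc-* n 1# x) (×-congʳ n (*-identityˡ x)))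

  ⟦⟧-homo-^ : ∀ m k → ⟦ m ⟧ ^ k ≈ ⟦ m ℕ.^ k ⟧
  ⟦⟧-homo-^ m zero    = sym ⟦1⟧≈1
  ⟦⟧-homo-^ m (suc k) = trans (*-congˡ (⟦⟧-homo-^ m k)) (sym (⟦⟧-homo-* m (m ℕ.^ k)))

  -x*y+x*y≈0 : ∀ x y → - x * y + x * y ≈ 0#
  -x*y+x*y≈0 x y = trans (+-congʳ (sym (-‿distribˡ-* x y))) (-‿inverseˡ _)

  *-cancelʳ-⟦⟧ : TorsionFree R → ∀ N .{{_ : NonZero N}} {a b} → a * ⟦ N ⟧ ≈ b * ⟦ N ⟧ → a ≈ b
  *-cancelʳ-⟦⟧ torsionFree N {a} {b} eq with torsionFree N (a - b) N×[a-b]≈0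
    where
    N×[a-b]≈0 : N × (a - b) ≈ 0#
    N×[a-b]≈0 = begin
      N × (a - b)               ≈⟨ ×≈⟦⟧* N (a - b) ⟩
      ⟦ N ⟧ * (a - b)           ≈⟨ *-comm _ _ ⟩
      (a - b) * ⟦ N ⟧           ≈⟨ [y-z]x≈yx-zx ⟦ N ⟧ a b ⟩
      a * ⟦ N ⟧ - b * ⟦ N ⟧     ≈⟨ +-congʳ eq ⟩
      b * ⟦ N ⟧ - b * ⟦ N ⟧     ≈⟨ -‿inverseʳ _ ⟩
      0#                        ∎
  ... | inj₁ N≡0  = contradiction N≡0 (ℕ.≢-nonZero⁻¹ N)
  ... | inj₂ a-b≈0 = x∙y⁻¹≈ε⇒x≈y a b a-b≈0

  fall-⟦⟧-vanishes : ∀ {j k} → j < k → fall ⟦ j ⟧ k ≈ 0#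
  fall-⟦⟧-vanishes {j} {suc k} (s≤s j≤k) with ℕ.m≤n⇒m<n∨m≡n j≤k
  ... | inj₁ j<k    = trans (*-congʳ (fall-⟦⟧-vanishes j<k)) (zeroˡ _)
  ... | inj₂ ≡.refl = trans (*-congˡ (-‿inverseʳ ⟦ j ⟧)) (zeroʳ _)

  fall-⟦⟧-*-! : ∀ {j k} → k ≤ j → fall ⟦ j ⟧ k * ⟦ (j ∸ k) ! ⟧ ≈ ⟦ j ! ⟧
  fall-⟦⟧-*-! {j} {zero}  _   = *-identityˡ _
  fall-⟦⟧-*-! {j} {suc k} k<j = begin
    fall ⟦ j ⟧ k * (⟦ j ⟧ - ⟦ k ⟧) * ⟦ (j ∸ suc k) ! ⟧
      ≈⟨ *-assoc _ _ _ ⟩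
    fall ⟦ j ⟧ k * ((⟦ j ⟧ - ⟦ k ⟧) * ⟦ (j ∸ suc k) ! ⟧)
      ≈⟨ *-congˡ (*-congʳ (⟦⟧-homo-∸ (ℕ.<⇒≤ k<j))) ⟨
    fall ⟦ j ⟧ k * (⟦ j ∸ k ⟧ * ⟦ (j ∸ suc k) ! ⟧)
      ≈⟨ *-congˡ (⟦⟧-homo-* (j ∸ k) _) ⟨
    fall ⟦ j ⟧ k * ⟦ (j ∸ k) ℕ.* (j ∸ suc k) ! ⟧
      ≡⟨ ≡.cong (λ i → fall ⟦ j ⟧ k * ⟦ i ⟧) ([n-k]*[n-k-1]!≡[n-k]! k<j) ⟩
    fall ⟦ j ⟧ k * ⟦ (j ∸ k) ! ⟧
      ≈⟨ fall-⟦⟧-*-! (ℕ.<⇒≤ k<j) ⟩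
    ⟦ j ! ⟧ ∎

  fall-⟦⟧-self : ∀ j → fall ⟦ j ⟧ j ≈ ⟦ j ! ⟧
  fall-⟦⟧-self j = begin
    fall ⟦ j ⟧ j                 ≈⟨ *-identityʳ _ ⟨
    fall ⟦ j ⟧ j * 1#            ≈⟨ *-congˡ ⟦1⟧≈1 ⟨
    fall ⟦ j ⟧ j * ⟦ 1 ⟧         ≡⟨ ≡.cong (λ i → fall ⟦ j ⟧ j * ⟦ i ! ⟧) (ℕ.n∸n≡0 j) ⟨
    fall ⟦ j ⟧ j * ⟦ (j ∸ j) ! ⟧  ≈⟨ fall-⟦⟧-*-! {j} ℕ.≤-refl ⟩
    ⟦ j ! ⟧                       ∎

  falling-coeffs-unique : TorsionFree R → ∀ n (a b : ℕ → Carrier) →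
    (∀ j → j ≤ n → sumTo (λ k → a k * fall ⟦ j ⟧ k) n ≈ sumTo (λ k → b k * fall ⟦ j ⟧ k) n) →
    ∀ k → k ≤ n → a k ≈ b k
  falling-coeffs-unique torsionFree n a b a≈b = <-rec (λ k → k ≤ n → a k ≈ b k) agree
    where
    truncated : ∀ (a : ℕ → Carrier) {j} → j ≤ n →
      sumTo (λ k → a k * fall ⟦ j ⟧ k) n ≈ sumTo (λ k → a k * fall ⟦ j ⟧ k) j
    truncated a j≤n = sumTo-truncate _ n j≤n λ k j<k _ → trans (*-congˡ (fall-⟦⟧-vanishes j<k)) (zeroʳ _)

    agree : ∀ j → (∀ {i} → i < j → i ≤ n → a i ≈ b i) → j ≤ n → a j ≈ b j
    agree j ih j≤n = *-cancelʳ-⟦⟧ torsionFree (j !) {{j ℕ.!≢0}} (begin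
      a j * ⟦ j ! ⟧       ≈⟨ *-congˡ (fall-⟦⟧-self j) ⟨
      a j * fall ⟦ j ⟧ j  ≈⟨ sumTo-≈⇒last-≈ j (λ i<j → *-congʳ (ih i<j (ℕ.<⇒≤ (ℕ.<-≤-trans i<j j≤n)))) sums-agree ⟩
      b j * fall ⟦ j ⟧ j  ≈⟨ *-congˡ (fall-⟦⟧-self j) ⟩
      b j * ⟦ j ! ⟧       ∎)
      where
      sums-agree : sumTo (λ k → a k * fall ⟦ j ⟧ k) j ≈ sumTo (λ k → b k * fall ⟦ j ⟧ k) j
      sums-agree = trans (sym (truncated a j≤n)) (trans (a≈b j j≤n) (truncated b j≤n))

  sumTo-pascal : ∀ n (f : ℕ → Carrier) →
    sumTo (λ i → ⟦ n C i ⟧ * f i) n + sumTo (λ i → ⟦ n C i ⟧ * f (suc i)) n ≈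
    sumTo (λ i → ⟦ suc n C i ⟧ * f i) (suc n)
  sumTo-pascal n f = begin
    sumTo (λ i → ⟦ n C i ⟧ * f i) n + shifted
      ≈⟨ +-congʳ (sumTo-truncate _ (suc n) (ℕ.n≤1+n n) λ k n<k _ → trans (*-congʳ (⟦C⟧-vanishes n<k)) (zeroˡ _)) ⟨
    sumTo (λ i → ⟦ n C i ⟧ * f i) (suc n) + shifted
      ≈⟨ +-congʳ (sumTo-head _ n) ⟩
    (⟦ n C 0 ⟧ * f 0 + sumTo (λ i → ⟦ n C suc i ⟧ * f (suc i)) n) + shifted
      ≈⟨ +-assoc _ _ _ ⟩
    ⟦ n C 0 ⟧ * f 0 + (sumTo (λ i → ⟦ n C suc i ⟧ * f (suc i)) n + shifted)
      ≈⟨ +-congˡ (sumTo-+ _ _ n) ⟨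
    ⟦ n C 0 ⟧ * f 0 + sumTo (λ i → ⟦ n C suc i ⟧ * f (suc i) + ⟦ n C i ⟧ * f (suc i)) n
      ≈⟨ +-congˡ (sumTo-cong n λ i _ → trans (sym (distribʳ _ _ _)) (*-congʳ pascal)) ⟩
    ⟦ n C 0 ⟧ * f 0 + sumTo (λ i → ⟦ suc n C suc i ⟧ * f (suc i)) n
      ≈⟨ sumTo-head _ n ⟨
    sumTo (λ i → ⟦ suc n C i ⟧ * f i) (suc n) ∎
    where
    shifted : Carrier
    shifted = sumTo (λ i → ⟦ n C i ⟧ * f (suc i)) n

    ⟦C⟧-vanishes : ∀ {k} → n < k → ⟦ n C k ⟧ ≈ 0#
    ⟦C⟧-vanishes n<k = reflexive (≡.cong ⟦_⟧ (k>n⇒nCk≡0 n<k))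

    pascal : ∀ {i} → ⟦ n C suc i ⟧ + ⟦ n C i ⟧ ≈ ⟦ suc n C suc i ⟧
    pascal {i} = trans (+-comm _ _) (trans (sym (⟦⟧-homo-+ (n C i) _)) (reflexive (≡.cong ⟦_⟧ (nCk+nC[k+1]≡[n+1]C[k+1] n i))))

  sumTo-*-onePlusδ : ∀ f n → sumTo (λ i → f i * onePlusδ i) n ≈ sumTo f n + f 0
  sumTo-*-onePlusδ f zero    = trans (distribˡ (f 0) 1# 1#) (+-cong (*-identityʳ _) (*-identityʳ _))
  sumTo-*-onePlusδ f (suc n) = begin
    sumTo (λ i → f i * onePlusδ i) n + f (suc n) * 1#  ≈⟨ +-cong (sumTo-*-onePlusδ f n) (*-identityʳ _) ⟩
    (sumTo f n + f 0) + f (suc n)                      ≈⟨ solve 3 (λ s a b → (s :+ a) :+ b := (s :+ b) :+ a) refl _ _ _ ⟩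
    sumTo f (suc n) + f 0                              ∎

  module _ (λ' : Carrier) where

    telescopeCoeff : ℕ → ℕ → Carrier
    telescopeCoeff n l = ⟦ n C l ⟧ * ⟦ (n ∸ l) ! ⟧ * (- λ') ^ (n ∸ l)

    telescopeCoeff-diag : ∀ n → telescopeCoeff n n ≈ 1#
    telescopeCoeff-diag n = begin
      ⟦ n C n ⟧ * ⟦ (n ∸ n) ! ⟧ * (- λ') ^ (n ∸ n)
        ≡⟨ ≡.cong₂ (λ a b → ⟦ a ⟧ * ⟦ b ! ⟧ * (- λ') ^ b) (nCn≡1 n) (ℕ.n∸n≡0 n) ⟩
      ⟦ 1 ⟧ * ⟦ 1 ⟧ * 1#                             ≈⟨ *-identityʳ _ ⟩
      ⟦ 1 ⟧ * ⟦ 1 ⟧                                  ≈⟨ *-cong ⟦1⟧≈1 ⟦1⟧≈1 ⟩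
      1# * 1#                                        ≈⟨ *-identityʳ 1# ⟩
      1#                                             ∎

    telescopeCoeff-suc : ∀ {n l} → l ≤ n → telescopeCoeff (suc n) l ≈ ⟦ suc n ⟧ * - λ' * telescopeCoeff n l
    telescopeCoeff-suc {n} {l} l≤n = begin
      ⟦ suc n C l ⟧ * ⟦ (suc n ∸ l) ! ⟧ * (- λ') ^ (suc n ∸ l)
        ≈⟨ *-congʳ (⟦⟧-homo-* (suc n C l) _) ⟨
      ⟦ (suc n C l) ℕ.* (suc n ∸ l) ! ⟧ * (- λ') ^ (suc n ∸ l)
        ≡⟨ ≡.cong₂ (λ a b → ⟦ a ⟧ * (- λ') ^ b) ([1+n]Cl*[1+n∸l]!≡[1+n]*nCl*[n∸l]! l≤n) (ℕ.+-∸-assoc 1 l≤n) ⟩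
      ⟦ suc n ℕ.* ((n C l) ℕ.* (n ∸ l) !) ⟧ * (- λ' * (- λ') ^ (n ∸ l))
        ≈⟨ *-congʳ (trans (⟦⟧-homo-* (suc n) ((n C l) ℕ.* (n ∸ l) !)) (*-congˡ (⟦⟧-homo-* (n C l) ((n ∸ l) !)))) ⟩
      ⟦ suc n ⟧ * (⟦ n C l ⟧ * ⟦ (n ∸ l) ! ⟧) * (- λ' * (- λ') ^ (n ∸ l))
        ≈⟨ solve 5 (λ N B F x p → N :* (B :* F) :* (x :* p) := N :* x :* (B :* F :* p)) refl _ _ _ _ _ ⟩
      ⟦ suc n ⟧ * - λ' * telescopeCoeff n l ∎

    sumTo-telescope : ∀ (u : ℕ → Carrier) n → sumTo (λ l → telescopeCoeff n l * (u (suc l) + l × λ' * u l)) n ≈ u (suc n)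
    sumTo-telescope u zero    = trans (*-congʳ (telescopeCoeff-diag 0))
      (solve 2 (λ u₁ u₀ → con 1 :* (u₁ :+ con 0 :* u₀) := u₁) refl (u 1) (u 0))
    sumTo-telescope u (suc n) = begin
      sumTo (λ l → telescopeCoeff (suc n) l * v l) n + telescopeCoeff (suc n) (suc n) * v (suc n)
        ≈⟨ +-cong (sumTo-cong n λ l l≤n → trans (*-congʳ (telescopeCoeff-suc l≤n)) (*-assoc _ _ _))
                  (trans (*-congʳ (telescopeCoeff-diag (suc n))) (*-identityˡ _)) ⟩
      sumTo (λ l → N * - λ' * (telescopeCoeff n l * v l)) n + (u (2 ℕ.+ n) + suc n × λ' * u (suc n))
        ≈⟨ +-cong (trans (sumTo-*ˡ _ _ n) (*-congˡ (sumTo-telescope u n))) (+-congˡ (*-congʳ (×≈⟦⟧* (suc n) λ'))) ⟩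
      N * - λ' * u (suc n) + (u (2 ℕ.+ n) + N * λ' * u (suc n))
        ≈⟨ solve 5 (λ N -l l u₁ u₂ → N :* -l :* u₁ :+ (u₂ :+ N :* l :* u₁) := u₂ :+ (-l :* (N :* u₁) :+ l :* (N :* u₁)))
             refl N (- λ') λ' (u (suc n)) (u (2 ℕ.+ n)) ⟩
      u (2 ℕ.+ n) + (- λ' * (N * u (suc n)) + λ' * (N * u (suc n)))
        ≈⟨ +-congˡ (-x*y+x*y≈0 λ' _) ⟩
      u (2 ℕ.+ n) + 0#
        ≈⟨ +-identityʳ _ ⟩
      u (2 ℕ.+ n) ∎
      where
      N : Carrier
      N = ⟦ suc n ⟧

      v : ℕ → Carrier
      v l = u (suc l) + l × λ' * u l

  module Whitney (m : ℕ) (λ' : Carrier) where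

    -- A coefficient sequence c stands for the polynomial Σ_k c_k m^k (x)_k; then `timesMX c` and
    -- `shift c` are the coefficients of mx · p(x) and of p(x + 1), since
    -- mx · m^k (x)_k = m^{k+1} (x)_{k+1} + mk · m^k (x)_k and (x+1)_k = (x)_k + k (x)_{k-1}.
    expansion : (ℕ → Carrier) → ℕ → Carrier → Carrier
    expansion c n x = sumTo (λ k → c k * ⟦ m ⟧ ^ k * fall x k) n

    lag : (ℕ → Carrier) → ℕ → Carrier
    lag c zero    = 0#
    lag c (suc k) = c k

    timesMX : (ℕ → Carrier) → ℕ → Carrier
    timesMX c k = lag c k + ⟦ m ⟧ * ⟦ k ⟧ * c k

    shift : (ℕ → Carrier) → ℕ → Carrier
    shift c k = c k + ⟦ m ⟧ * ⟦ suc k ⟧ * c (suc k)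

    whitney : ℕ → ℕ → Carrier
    whitney zero    zero    = 1#
    whitney zero    (suc k) = 0#
    whitney (suc n) k       = timesMX (whitney n) k + (1# - n × λ') * whitney n k

    dowling : ℕ → Carrier
    dowling n = sumTo (whitney n) n

    whitney-vanishes : ∀ {n k} → n < k → whitney n k ≈ 0#
    whitney-vanishes {zero}  {suc k} _         = refl
    whitney-vanishes {suc n} {suc k} (s≤s n<k) = begin
      whitney n k + ⟦ m ⟧ * ⟦ suc k ⟧ * whitney n (suc k) + (1# - n × λ') * whitney n (suc k)
        ≈⟨ +-cong (+-cong (whitney-vanishes n<k) (*-congˡ w≈0)) (*-congˡ w≈0) ⟩
      0# + ⟦ m ⟧ * ⟦ suc k ⟧ * 0# + (1# - n × λ') * 0#
        ≈⟨ solve 2 (λ a b → con 0 :+ a :* con 0 :+ b :* con 0 := con 0) refl _ _ ⟩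
      0# ∎
      where
      w≈0 : whitney n (suc k) ≈ 0#
      w≈0 = whitney-vanishes (ℕ.m≤n⇒m≤1+n n<k)

    sumTo-lag : ∀ c n → sumTo (lag c) (suc n) ≈ sumTo c n
    sumTo-lag c n = trans (sumTo-head (lag c) n) (+-identityˡ _)

    basis : Carrier → ℕ → Carrier
    basis x k = ⟦ m ⟧ ^ k * fall x k

    mx*basis : ∀ x k → ⟦ m ⟧ * x * basis x k ≈ basis x (suc k) + ⟦ m ⟧ * ⟦ k ⟧ * basis x k
    mx*basis x k = begin
      M * x * (Mᵏ * F)                          ≈⟨ *-congʳ (*-congˡ (//-rightDividesˡ K x)) ⟨
      M * ((x - K) + K) * (Mᵏ * F)
        ≈⟨ solve 5 (λ M Mᵏ F y K → M :* (y :+ K) :* (Mᵏ :* F) := M :* Mᵏ :* (F :* y) :+ M :* K :* (Mᵏ :* F))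
             refl M Mᵏ F (x - K) K ⟩
      M * Mᵏ * (F * (x - K)) + M * K * (Mᵏ * F) ∎
      where
      M Mᵏ F K : Carrier
      M = ⟦ m ⟧
      Mᵏ = ⟦ m ⟧ ^ k
      F = fall x k
      K = ⟦ k ⟧

    expansion-timesMX : ∀ c n x → c (suc n) ≈ 0# →
      expansion (timesMX c) (suc n) x ≈ ⟦ m ⟧ * x * expansion c n x
    expansion-timesMX c n x c₁₊ₙ≈0 = begin
      sumTo (λ k → timesMX c k * ⟦ m ⟧ ^ k * fall x k) (suc n)
        ≈⟨ sumTo-cong (suc n) (λ k _ → split k) ⟩
      sumTo (λ k → lag c k * basis x k + c k * (⟦ m ⟧ * ⟦ k ⟧ * basis x k)) (suc n)
        ≈⟨ sumTo-+ _ _ (suc n) ⟩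
      sumTo (λ k → lag c k * basis x k) (suc n) + sumTo (λ k → c k * (⟦ m ⟧ * ⟦ k ⟧ * basis x k)) (suc n)
        ≈⟨ +-cong (trans (sumTo-cong (suc n) λ k _ → lag-* k) (sumTo-lag _ n))
                  (sumTo-truncate _ (suc n) (ℕ.n≤1+n n) λ k n<k k≤1+n → top-vanishes n<k k≤1+n) ⟩
      sumTo (λ k → c k * basis x (suc k)) n + sumTo (λ k → c k * (⟦ m ⟧ * ⟦ k ⟧ * basis x k)) n
        ≈⟨ sumTo-+ _ _ n ⟨
      sumTo (λ k → c k * basis x (suc k) + c k * (⟦ m ⟧ * ⟦ k ⟧ * basis x k)) n
        ≈⟨ sumTo-cong n (λ k _ → trans (sym (distribˡ _ _ _)) (*-congˡ (sym (mx*basis x k)))) ⟩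
      sumTo (λ k → c k * (⟦ m ⟧ * x * basis x k)) n
        ≈⟨ sumTo-cong n (λ k _ → solve 4 (λ c y Mᵏ F → c :* (y :* (Mᵏ :* F)) := y :* (c :* Mᵏ :* F))
                                   refl (c k) (⟦ m ⟧ * x) _ _) ⟩
      sumTo (λ k → ⟦ m ⟧ * x * (c k * ⟦ m ⟧ ^ k * fall x k)) n
        ≈⟨ sumTo-*ˡ _ _ n ⟩
      ⟦ m ⟧ * x * expansion c n x ∎
      where
      split : ∀ k → timesMX c k * ⟦ m ⟧ ^ k * fall x k ≈ lag c k * basis x k + c k * (⟦ m ⟧ * ⟦ k ⟧ * basis x k)
      split k = solve 6 (λ l M K c Mᵏ F → (l :+ M :* K :* c) :* Mᵏ :* F := l :* (Mᵏ :* F) :+ c :* (M :* K :* (Mᵏ :* F)))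
                  refl (lag c k) ⟦ m ⟧ ⟦ k ⟧ (c k) _ _

      lag-* : ∀ k → lag c k * basis x k ≈ lag (λ j → c j * basis x (suc j)) k
      lag-* zero    = zeroˡ _
      lag-* (suc k) = refl

      top-vanishes : ∀ {k} → n < k → k ≤ suc n → c k * (⟦ m ⟧ * ⟦ k ⟧ * basis x k) ≈ 0#
      top-vanishes n<k k≤1+n with ℕ.≤-antisym n<k k≤1+n
      ... | ≡.refl = trans (*-congʳ c₁₊ₙ≈0) (zeroˡ _)

    whitney-expansion : ∀ n x → fallλ (⟦ m ⟧ * x + 1#) n λ' ≈ expansion (whitney n) n x
    whitney-expansion zero    x = sym (trans (*-identityʳ _) (*-identityʳ _))
    whitney-expansion (suc n) x = begin
      fallλ y n λ' * (y - n × λ')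
        ≈⟨ *-congʳ (whitney-expansion n x) ⟩
      expansion w n x * (y - n × λ')
        ≈⟨ solve 4 (λ E mx one -nλ → E :* ((mx :+ one) :+ -nλ) := mx :* E :+ (one :+ -nλ) :* E)
             refl _ (⟦ m ⟧ * x) 1# (- (n × λ')) ⟩
      ⟦ m ⟧ * x * expansion w n x + a * expansion w n x
        ≈⟨ +-cong (expansion-timesMX w n x (whitney-vanishes (ℕ.n<1+n n))) (*-congˡ extend) ⟨
      expansion (timesMX w) (suc n) x + a * expansion w (suc n) x
        ≈⟨ +-congˡ (sumTo-*ˡ _ _ (suc n)) ⟨
      sumTo (λ k → timesMX w k * ⟦ m ⟧ ^ k * fall x k) (suc n) + sumTo (λ k → a * (w k * ⟦ m ⟧ ^ k * fall x k)) (suc n)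
        ≈⟨ sumTo-+ _ _ (suc n) ⟨
      sumTo (λ k → timesMX w k * ⟦ m ⟧ ^ k * fall x k + a * (w k * ⟦ m ⟧ ^ k * fall x k)) (suc n)
        ≈⟨ sumTo-cong (suc n) (λ k _ → solve 5 (λ t a w Mᵏ F → t :* Mᵏ :* F :+ a :* (w :* Mᵏ :* F) := (t :+ a :* w) :* Mᵏ :* F)
                                         refl _ a _ _ _) ⟩
      expansion (whitney (suc n)) (suc n) x ∎
      where
      y a : Carrier
      y = ⟦ m ⟧ * x + 1#
      a = 1# - n × λ'

      w : ℕ → Carrier
      w = whitney n

      extend : expansion w (suc n) x ≈ expansion w n x
      extend = sumTo-truncate _ (suc n) (ℕ.n≤1+n n) λ k n<k _ →
        trans (*-congʳ (trans (*-congʳ (whitney-vanishes n<k)) (zeroˡ _))) (zeroˡ _)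

    whitney-unique : TorsionFree R → m ≥ 1 → ∀ {W} → IsDegWhitney2 R m λ' W →
      ∀ n k → k ≤ n → W n k ≈ whitney n k
    whitney-unique torsionFree m≥1 {W} isW n k k≤n =
      *-cancelʳ-⟦⟧ torsionFree (m ℕ.^ k) {{ℕ.m^n≢0 m k {{ℕ.>-nonZero m≥1}}}} (begin
        W n k * ⟦ m ℕ.^ k ⟧        ≈⟨ *-congˡ (⟦⟧-homo-^ m k) ⟨
        W n k * ⟦ m ⟧ ^ k          ≈⟨ falling-coeffs-unique torsionFree n _ _ expansions-agree k k≤n ⟩
        whitney n k * ⟦ m ⟧ ^ k    ≈⟨ *-congˡ (⟦⟧-homo-^ m k) ⟩
        whitney n k * ⟦ m ℕ.^ k ⟧  ∎)
      where
      expansions-agree : ∀ j → j ≤ n → expansion (W n) n ⟦ j ⟧ ≈ expansion (whitney n) n ⟦ j ⟧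
      expansions-agree j _ = trans (sym (isW n ⟦ j ⟧)) (whitney-expansion n ⟦ j ⟧)

    dowling-unique : TorsionFree R → m ≥ 1 → ∀ {W} → IsDegWhitney2 R m λ' W → ∀ n → Dowling R W n ≈ dowling n
    dowling-unique torsionFree m≥1 isW n = sumTo-cong n (whitney-unique torsionFree m≥1 isW n)

    timesMX-zero : ∀ c → timesMX c 0 ≈ 0#
    timesMX-zero c = trans (+-identityˡ _) (trans (*-congʳ (zeroʳ _)) (zeroˡ _))

    timesMX-cong : ∀ {c d} → (∀ j → c j ≈ d j) → ∀ k → timesMX c k ≈ timesMX d k
    timesMX-cong c≈d zero    = +-congˡ (*-congˡ (c≈d 0))
    timesMX-cong c≈d (suc k) = +-cong (c≈d k) (*-congˡ (c≈d (suc k)))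

    timesMX-sumTo : ∀ (g : ℕ → Carrier) (Q : ℕ → ℕ → Carrier) n k →
      timesMX (λ j → sumTo (λ i → g i * Q i j) n) k ≈ sumTo (λ i → g i * timesMX (Q i) k) n
    timesMX-sumTo g Q n k = begin
      lag (λ j → sumTo (λ i → g i * Q i j) n) k + ⟦ m ⟧ * ⟦ k ⟧ * sumTo (λ i → g i * Q i k) n
        ≈⟨ +-cong (lag-sumTo k) (sumTo-*ˡ _ _ n) ⟨
      sumTo (λ i → g i * lag (Q i) k) n + sumTo (λ i → ⟦ m ⟧ * ⟦ k ⟧ * (g i * Q i k)) n
        ≈⟨ sumTo-+ _ _ n ⟨
      sumTo (λ i → g i * lag (Q i) k + ⟦ m ⟧ * ⟦ k ⟧ * (g i * Q i k)) n
        ≈⟨ sumTo-cong n (λ i _ → solve 4 (λ g l M q → g :* l :+ M :* (g :* q) := g :* (l :+ M :* q))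
                                   refl (g i) _ (⟦ m ⟧ * ⟦ k ⟧) _) ⟩
      sumTo (λ i → g i * timesMX (Q i) k) n ∎
      where
      lag-sumTo : ∀ k → sumTo (λ i → g i * lag (Q i) k) n ≈ lag (λ j → sumTo (λ i → g i * Q i j) n) k
      lag-sumTo zero    = sumTo-zero _ n λ i _ → zeroʳ (g i)
      lag-sumTo (suc k) = refl

    sumTo-timesMX : ∀ c n → sumTo (timesMX c) (suc n) ≈ sumTo (shift c) n
    sumTo-timesMX c n = trans (sumTo-head (timesMX c) n) (trans (+-congʳ (timesMX-zero c)) (+-identityˡ _))

    shift-timesMX : ∀ c α k →
      shift (λ j → timesMX c j + α * c j) k ≈ timesMX (shift c) k + (⟦ m ⟧ + α) * shift c k
    shift-timesMX c α k = begin
      (timesMX c k + α * c k) + ⟦ m ⟧ * ⟦ suc k ⟧ * (shift c k + α * c (suc k))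
        ≈⟨ solve 6 (λ t α c c′ M K →
             (t :+ α :* c) :+ M :* (con 1 :+ K) :* ((c :+ M :* (con 1 :+ K) :* c′) :+ α :* c′) :=
             (t :+ M :* K :* (c :+ M :* (con 1 :+ K) :* c′)) :+ (M :+ α) :* (c :+ M :* (con 1 :+ K) :* c′))
           refl _ α (c k) (c (suc k)) ⟦ m ⟧ ⟦ k ⟧ ⟩
      (timesMX c k + ⟦ m ⟧ * ⟦ k ⟧ * shift c k) + (⟦ m ⟧ + α) * shift c k
        ≈⟨ +-congʳ (+-congʳ (lag-shift k)) ⟨
      timesMX (shift c) k + (⟦ m ⟧ + α) * shift c k ∎
      where
      lag-shift : ∀ k → lag (shift c) k ≈ timesMX c k
      lag-shift zero    = sym (timesMX-zero c)
      lag-shift (suc k) = refl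

    -- The degenerate Vandermonde identity for (m(x+1)+1)_{n,λ}, read on coefficients.
    shift-whitney : ∀ n k →
      shift (whitney n) k ≈ sumTo (λ i → ⟦ n C i ⟧ * fallλ ⟦ m ⟧ i λ' * whitney (n ∸ i) k) n
    shift-whitney zero    k =
      solve 3 (λ w M K → w :+ M :* K :* con 0 := (con 1 :+ con 0) :* con 1 :* w) refl (whitney 0 k) ⟦ m ⟧ ⟦ suc k ⟧
    shift-whitney (suc n) k = begin
      shift (whitney (suc n)) k
        ≈⟨ shift-timesMX (whitney n) a k ⟩
      timesMX (shift (whitney n)) k + (⟦ m ⟧ + a) * shift (whitney n) k
        ≈⟨ +-cong (timesMX-cong (shift-whitney n) k) (*-congˡ (shift-whitney n k)) ⟩
      timesMX (λ j → sumTo (λ i → g i * whitney (n ∸ i) j) n) k + (⟦ m ⟧ + a) * sumTo (λ i → g i * whitney (n ∸ i) k) n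
        ≈⟨ +-cong (timesMX-sumTo g (λ i → whitney (n ∸ i)) n k) (sym (sumTo-*ˡ _ _ n)) ⟩
      sumTo (λ i → g i * timesMX (whitney (n ∸ i)) k) n + sumTo (λ i → (⟦ m ⟧ + a) * (g i * whitney (n ∸ i) k)) n
        ≈⟨ sumTo-+ _ _ n ⟨
      sumTo (λ i → g i * timesMX (whitney (n ∸ i)) k + (⟦ m ⟧ + a) * (g i * whitney (n ∸ i) k)) n
        ≈⟨ sumTo-cong n pascal-summands ⟩
      sumTo (λ i → ⟦ n C i ⟧ * f i + ⟦ n C i ⟧ * f (suc i)) n
        ≈⟨ sumTo-+ _ _ n ⟩
      sumTo (λ i → ⟦ n C i ⟧ * f i) n + sumTo (λ i → ⟦ n C i ⟧ * f (suc i)) n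
        ≈⟨ sumTo-pascal n f ⟩
      sumTo (λ i → ⟦ suc n C i ⟧ * f i) (suc n)
        ≈⟨ sumTo-cong (suc n) (λ i _ → sym (*-assoc _ _ _)) ⟩
      sumTo (λ i → ⟦ suc n C i ⟧ * fallλ ⟦ m ⟧ i λ' * whitney (suc n ∸ i) k) (suc n) ∎
      where
      a : Carrier
      a = 1# - n × λ'

      g : ℕ → Carrier
      g i = ⟦ n C i ⟧ * fallλ ⟦ m ⟧ i λ'

      f : ℕ → Carrier
      f i = fallλ ⟦ m ⟧ i λ' * whitney (suc n ∸ i) k

      pascal-summands : ∀ i → i ≤ n →
        g i * timesMX (whitney (n ∸ i)) k + (⟦ m ⟧ + a) * (g i * whitney (n ∸ i) k) ≈ ⟦ n C i ⟧ * f i + ⟦ n C i ⟧ * f (suc i)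
      pascal-summands i i≤n = begin
        B * F * T + (⟦ m ⟧ + (1# - n × λ')) * (B * F * w)
          ≈⟨ +-congˡ (*-congʳ (+-congˡ (+-congˡ -nλ≈-[n∸i]λ-iλ))) ⟩
        B * F * T + (⟦ m ⟧ + (1# + (- ((n ∸ i) × λ') + - (i × λ')))) * (B * F * w)
          ≈⟨ solve 7 (λ B F T M -u -v w →
               B :* F :* T :+ (M :+ (con 1 :+ (-u :+ -v))) :* (B :* F :* w) :=
               B :* (F :* (T :+ (con 1 :+ -u) :* w)) :+ B :* (F :* (M :+ -v) :* w))
             refl B F T ⟦ m ⟧ _ _ w ⟩
        B * (F * whitney (suc (n ∸ i)) k) + B * f (suc i)
          ≡⟨ ≡.cong (λ j → B * (F * whitney j k) + B * f (suc i)) (ℕ.+-∸-assoc 1 i≤n) ⟨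
        B * f i + B * f (suc i) ∎
        where
        B F T w : Carrier
        B = ⟦ n C i ⟧
        F = fallλ ⟦ m ⟧ i λ'
        T = timesMX (whitney (n ∸ i)) k
        w = whitney (n ∸ i) k

        -nλ≈-[n∸i]λ-iλ : - (n × λ') ≈ - ((n ∸ i) × λ') + - (i × λ')
        -nλ≈-[n∸i]λ-iλ = begin
          - (n × λ')                        ≡⟨ ≡.cong (λ j → - (j × λ')) (ℕ.m∸n+n≡m i≤n) ⟨
          - ((n ∸ i ℕ.+ i) × λ')            ≈⟨ -‿cong (×-homo-+ λ' (n ∸ i) i) ⟩
          - ((n ∸ i) × λ' + i × λ')         ≈⟨ ⁻¹-∙-comm _ _ ⟨
          - ((n ∸ i) × λ') + - (i × λ')     ∎

    dowling-suc : ∀ n → dowling (suc n) ≈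
      sumTo (λ i → ⟦ n C i ⟧ * fallλ ⟦ m ⟧ i λ' * dowling (n ∸ i)) n + (1# - n × λ') * dowling n
    dowling-suc n = begin
      sumTo (λ k → timesMX w k + a * w k) (suc n)
        ≈⟨ sumTo-+ _ _ (suc n) ⟩
      sumTo (timesMX w) (suc n) + sumTo (λ k → a * w k) (suc n)
        ≈⟨ +-cong (sumTo-timesMX w n) (trans (sumTo-*ˡ a w (suc n)) (*-congˡ (dowling-truncate (ℕ.n≤1+n n)))) ⟩
      sumTo (shift w) n + a * dowling n
        ≈⟨ +-congʳ (sumTo-cong n (λ k _ → shift-whitney n k)) ⟩
      sumTo (λ k → sumTo (λ i → g i * whitney (n ∸ i) k) n) n + a * dowling n
        ≈⟨ +-congʳ (sumTo-comm (λ i k → g i * whitney (n ∸ i) k) n n) ⟨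
      sumTo (λ i → sumTo (λ k → g i * whitney (n ∸ i) k) n) n + a * dowling n
        ≈⟨ +-congʳ (sumTo-cong n λ i _ → trans (sumTo-*ˡ _ _ n) (*-congˡ (dowling-truncate (ℕ.m∸n≤m n i)))) ⟩
      sumTo (λ i → g i * dowling (n ∸ i)) n + a * dowling n ∎
      where
      w : ℕ → Carrier
      w = whitney n

      a : Carrier
      a = 1# - n × λ'

      g : ℕ → Carrier
      g i = ⟦ n C i ⟧ * fallλ ⟦ m ⟧ i λ'

      dowling-truncate : ∀ {j N} → j ≤ N → sumTo (whitney j) N ≈ dowling j
      dowling-truncate j≤N = sumTo-truncate _ _ j≤N λ k j<k _ → whitney-vanishes j<k

    sumTo-dowling-onePlusδ : ∀ l →
      sumTo (λ i → ⟦ l C i ⟧ * fallλ ⟦ m ⟧ i λ' * dowling (l ∸ i) * onePlusδ i) l ≈ dowling (suc l) + l × λ' * dowling l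
    sumTo-dowling-onePlusδ l = begin
      sumTo (λ i → g i * dowling (l ∸ i) * onePlusδ i) l
        ≈⟨ sumTo-*-onePlusδ _ l ⟩
      S + ⟦ 1 ⟧ * 1# * dowling l
        ≈⟨ +-congˡ (trans (*-congʳ (trans (*-identityʳ _) ⟦1⟧≈1)) (*-identityˡ _)) ⟩
      S + d
        ≈⟨ +-congˡ (trans (+-congˡ (-x*y+x*y≈0 u d)) (+-identityʳ d)) ⟨
      S + (d + (- u * d + u * d))
        ≈⟨ solve 4 (λ S d -u u → S :+ (d :+ (-u :* d :+ u :* d)) := (S :+ (con 1 :+ -u) :* d) :+ u :* d) refl S d (- u) u ⟩
      (S + (1# - u) * d) + u * d
        ≈⟨ +-congʳ (dowling-suc l) ⟨
      dowling (suc l) + u * d ∎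
      where
      g : ℕ → Carrier
      g i = ⟦ l C i ⟧ * fallλ ⟦ m ⟧ i λ'

      S u d : Carrier
      S = sumTo (λ i → g i * dowling (l ∸ i)) l
      u = l × λ'
      d = dowling l

theorem17 : ∀ {c ℓ} (R : CommutativeRing c ℓ) → TorsionFree R →
    (m : ℕ) → m ≥ 1 →
    (λ' : CommutativeRing.Carrier R) → ¬ (CommutativeRing._≈_ R λ' (CommutativeRing.0# R)) →
    (W : ℕ → ℕ → CommutativeRing.Carrier R) → IsDegWhitney2 R m λ' W →
    (n : ℕ) →
    CommutativeRing._≈_ R (Dowling R W (suc n)) (theorem17-rhs R m λ' W n)
-- The identity holds for every λ.
theorem17 R torsionFree m m≥1 λ' _ W isW n = begin
  Dowling R W (suc n)
    ≈⟨ dowling-unique torsionFree m≥1 isW (suc n) ⟩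
  dowling (suc n)
    ≈⟨ sumTo-telescope λ' dowling n ⟨
  sumTo (λ l → telescopeCoeff λ' n l * (dowling (suc l) + l × λ' * dowling l)) n
    ≈⟨ sumTo-cong n (λ l _ → *-congˡ (sumTo-dowling-onePlusδ l)) ⟨
  sumTo (λ l → telescopeCoeff λ' n l * sumTo (λ i → ⟦ l C i ⟧ * fallλ ⟦ m ⟧ i λ' * dowling (l ∸ i) * onePlusδ i) l) n
    ≈⟨ sumTo-cong n (λ l _ → trans (sumTo-cong l λ i _ → summand l i) (sumTo-*ˡ _ _ l)) ⟨
  theorem17-rhs R m λ' W n ∎
  where
  open CommutativeRing R
  open RawSemiringDefs (Semiring.rawSemiring semiring) using (_×_; _^_)
  open DegenerateDowling R
  open Whitney m λ'
  open SemiringSolver commutativeSemiring using (solve; _:=_; _:*_)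
  open import Relation.Binary.Reasoning.Setoid setoid

  summand : ∀ l i →
    ⟦ l C i ⟧ * ⟦ n C l ⟧ * ⟦ (n ∸ l) ! ⟧ * (- λ') ^ (n ∸ l) * fallλ ⟦ m ⟧ i λ' * Dowling R W (l ∸ i) * onePlusδ i ≈
    telescopeCoeff λ' n l * (⟦ l C i ⟧ * fallλ ⟦ m ⟧ i λ' * dowling (l ∸ i) * onePlusδ i)
  summand l i = trans (*-congʳ (*-congˡ (dowling-unique torsionFree m≥1 isW (l ∸ i))))
    (solve 7 (λ a b f p F D δ → a :* b :* f :* p :* F :* D :* δ := b :* f :* p :* (a :* F :* D :* δ)) refl _ _ _ _ _ _ _)
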